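{- Let $X$ be a finite set, let $\alpha,\beta\in\mathcal{T}(X)$ and let $\gamma\in\mathcal{P}(X)\setminus\mathcal{T}(X)$ be such that $\alpha\gamma=\gamma\alpha$ and $\beta\gamma=\gamma\beta$. If the graph $G(\alpha,\beta)$ is connected, then $\gamma=\emptyset$.
   Context: $\mathcal{P}(X)$ is the semigroup of all partial transformations of $X$ (functions with domain and image contained in $X$, including the empty map $\emptyset$) under composition, maps acting on the right ($x(\alpha\beta)=(x\alpha)\beta$, defined iff $x\in\mathrm{dom}\,\alpha$ and $x\alpha\in\mathrm{dom}\,\beta$). $\mathcal{T}(X)$ is the set of full transformations (domain $X$). For $\alpha,\beta\in\mathcal{T}(X)$, $G(\alpha,\beta)$ is the simple graph with vertex set $X$ in which two distinct $x,y\in X$ are adjacent iff $x\alpha=y$ or $y\alpha=x$ or $x\beta=y$ or $y\beta=x$. -}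

module Defs where

open import Data.Nat using (ℕ)
open import Data.Fin using (Fin)
open import Data.Maybe using (Maybe; just; nothing)
open import Data.Product using (∃)
open import Data.Sum using (_⊎_)
open import Relation.Binary.PropositionalEquality using (_≡_; _≢_)
open import Relation.Binary.Construct.Closure.ReflexiveTransitive using (Star)

-- The finite set X is modelled as Fin n (every finite set is in bijection
-- with some Fin n, and the statement is invariant under relabelling).

Full : ℕ → Set
Full n = Fin n → Fin n

-- Partial transformations P(X): x ↦ just (xγ) if x ∈ dom γ, nothing otherwise
Partial : ℕ → Set
Partial n = Fin n → Maybe (Fin n)

full⇒partial : ∀ {n} → Full n → Partial n
full⇒partial α x = just (α x)

-- Composition in P(X), maps acting on the right: x(αβ) = (xα)β
_⨾_ : ∀ {n} → Partial n → Partial n → Partial n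
(α ⨾ β) x with α x
... | nothing = nothing
... | just y  = β y

-- γ ∈ T(X) iff dom γ = X; so γ ∉ T(X) iff some point is outside the domain
NotFull : ∀ {n} → Partial n → Set
NotFull {n} γ = ∃ λ (x : Fin n) → γ x ≡ nothing

IsEmptyMap : ∀ {n} → Partial n → Set
IsEmptyMap γ = ∀ x → γ x ≡ nothing

Adj : ∀ {n} → Full n → Full n → Fin n → Fin n → Set
Adj α β x y = x ≢ y × (α x ≡ y ⊎ α y ≡ x ⊎ β x ≡ y ⊎ β y ≡ x)
  where open import Data.Product using (_×_)

Connected : ∀ {n} → Full n → Full n → Set
Connected {n} α β = (x y : Fin n) → Star (Adj α β) x y

module Submission where

-- If a partial map γ commutes with a full map f, then x ∉ dom γ iff xf ∉ dom γ,
-- since xfγ = xγf. So the complement of dom γ is a union of connected components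
-- of G(α, β); it is nonempty as γ ∉ T(X), hence everything by connectivity.

open import Defs
open import Data.Nat using (ℕ)
open import Data.Fin using (Fin)
open import Data.Maybe using (just; nothing)
open import Data.Product using (_,_)
open import Data.Sum using (inj₁; inj₂)
open import Function using (id; _∘_)
open import Relation.Binary.PropositionalEquality using (_≡_; refl; trans; sym)
open import Relation.Binary.Construct.Closure.ReflexiveTransitive using (Star; fold)

module _ {n : ℕ} where

  Commutes : Full n → Partial n → Set
  Commutes f γ = ∀ x → (full⇒partial f ⨾ γ) x ≡ (γ ⨾ full⇒partial f) x

  _∉dom_ : Fin n → Partial n → Set
  x ∉dom γ = γ x ≡ nothing

  ∉dom-image : ∀ {γ} f → Commutes f γ → ∀ x → x ∉dom γ → f x ∉dom γ
  ∉dom-image {γ} f f⨾γ≡γ⨾f x x∉dom with γ x | f⨾γ≡γ⨾f x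
  ... | nothing | fx∉dom = fx∉dom

  ∉dom-preimage : ∀ {γ} f → Commutes f γ → ∀ x → f x ∉dom γ → x ∉dom γ
  ∉dom-preimage {γ} f f⨾γ≡γ⨾f x fx∉dom with γ x | f⨾γ≡γ⨾f x
  ... | nothing | _ = refl
  ... | just _  | γfx≡just with () ← trans (sym fx∉dom) γfx≡just

  module _ {α β : Full n} {γ : Partial n} (α-comm : Commutes α γ) (β-comm : Commutes β γ) where

    ∉dom-along-edge : ∀ {x y} → Adj α β x y → x ∉dom γ → y ∉dom γ
    ∉dom-along-edge {x}     (_ , inj₁ refl)               = ∉dom-image {γ} α α-comm x
    ∉dom-along-edge {y = y} (_ , inj₂ (inj₁ refl))        = ∉dom-preimage {γ} α α-comm y
    ∉dom-along-edge {x}     (_ , inj₂ (inj₂ (inj₁ refl))) = ∉dom-image {γ} β β-comm x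
    ∉dom-along-edge {y = y} (_ , inj₂ (inj₂ (inj₂ refl))) = ∉dom-preimage {γ} β β-comm y

    ∉dom-along-walk : ∀ {x y} → Star (Adj α β) x y → x ∉dom γ → y ∉dom γ
    ∉dom-along-walk = fold (λ x y → x ∉dom γ → y ∉dom γ) (λ edge rest → rest ∘ ∉dom-along-edge edge) id

lemma3p6 : (n : ℕ) (α β : Full n) (γ : Partial n)
    → NotFull γ
    → (∀ x → (full⇒partial α ⨾ γ) x ≡ (γ ⨾ full⇒partial α) x)
    → (∀ x → (full⇒partial β ⨾ γ) x ≡ (γ ⨾ full⇒partial β) x)
    → Connected α β
    → IsEmptyMap γ
lemma3p6 n α β γ (x , x∉dom) α-comm β-comm connected y =
  ∉dom-along-walk α-comm β-comm (connected x y) x∉dom
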